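{- Let $H\colon\mathbb{R}^k\times\mathbb{R}^k\to\mathbb{R}$ be a real polynomial, let $X\subset\mathbb{R}^k$ be non-empty, and suppose $H(x,y)=0$ for all $x,y\in X$. Then $H(x,y)=0$ for all $x,y\in\overline{X}^H$.
   Context: For a real polynomial $H(x,y)$ on $\mathbb{R}^k\times\mathbb{R}^k$ and $x,y\in\mathbb{R}^k$, let $H_x(y)=H(x,y)$ (a polynomial in $y$) and $H^y(x)=H(x,y)$ (a polynomial in $x$), with zero sets $Z(H_x)=\{y\in\mathbb{R}^k: H(x,y)=0\}$ and $Z(H^y)=\{x\in\mathbb{R}^k: H(x,y)=0\}$. For $X\subset\mathbb{R}^k$ define the restricted Zariski closure $$\overline{X}^H=\bigcap_{\substack{x\in\mathbb{R}^k\\ X\subset Z(H_x)}} Z(H_x)\ \cap\ \bigcap_{\substack{y\in\mathbb{R}^k\\ X\subset Z(H^y)}} Z(H^y),$$ with the convention $\overline{X}^H=\mathbb{R}^k$ if there are no sets in the intersection. -}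

module Defs where

open import Level using (Level; _⊔_) renaming (suc to lsuc)
open import Data.Nat using (ℕ)
open import Data.Fin using (Fin)
open import Data.Sum using (_⊎_; inj₁; inj₂)
open import Data.Product using (Σ; ∃; _×_; _,_)
open import Relation.Nullary using (¬_)
open import Algebra.Bundles using (CommutativeRing)

record RealField (c ℓ : Level) : Set (lsuc (c ⊔ ℓ)) where
  field
    commRing : CommutativeRing c ℓ
  open CommutativeRing commRing public
  field
    _<_        : Carrier → Carrier → Set ℓ
    <-irrefl   : ∀ {a b} → a ≈ b → ¬ (a < b)
    <-trans    : ∀ {a b d} → a < b → b < d → a < d
    <-resp-≈   : ∀ {a a′ b b′} → a ≈ a′ → b ≈ b′ → a < b → a′ < b′
    <-trichot  : ∀ a b → (a < b) ⊎ ((a ≈ b) ⊎ (b < a))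
    +-mono-<   : ∀ {a b} d → a < b → (a + d) < (b + d)
    *-pos      : ∀ {a b} → 0# < a → 0# < b → 0# < (a * b)
    0<1        : 0# < 1#
    inverse    : ∀ a → ¬ (a ≈ 0#) → Σ Carrier λ b → (a * b) ≈ 1#
    sup        : (S : Carrier → Set ℓ) → (∃ λ a → S a) →
                 (∃ λ u → ∀ a → S a → (a < u) ⊎ (a ≈ u)) →
                 Σ Carrier λ s → (∀ a → S a → (a < s) ⊎ (a ≈ s))
                                × (∀ u → (∀ a → S a → (a < u) ⊎ (a ≈ u)) →
                                         (s < u) ⊎ (s ≈ u))

-- Polynomials in finitely many variables indexed by V, as syntax.
-- Every real polynomial function arises as the evaluation of such a term.

data Poly {c : Level} (A : Set c) (V : Set) : Set c where
  con  : A → Poly A V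
  var  : V → Poly A V
  _⊕_  : Poly A V → Poly A V → Poly A V
  _⊛_  : Poly A V → Poly A V → Poly A V

module _ {c ℓ : Level} (R : RealField c ℓ) where
  open RealField R

  Vecℝ : ℕ → Set c
  Vecℝ k = Fin k → Carrier

  -- A real polynomial on ℝ^k × ℝ^k: variables inj₁ i are the x-coordinates,
  -- inj₂ i the y-coordinates.
  Poly2 : ℕ → Set c
  Poly2 k = Poly Carrier (Fin k ⊎ Fin k)

  eval : {V : Set} → Poly Carrier V → (V → Carrier) → Carrier
  eval (con a)  ρ = a
  eval (var v)  ρ = ρ v
  eval (p ⊕ q)  ρ = eval p ρ + eval q ρ
  eval (p ⊛ q)  ρ = eval p ρ * eval q ρ

  evalH : ∀ {k} → Poly2 k → Vecℝ k → Vecℝ k → Carrier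
  evalH H x y = eval H λ { (inj₁ i) → x i ; (inj₂ i) → y i }

  Subset : ℕ → (ℓ′ : Level) → Set (c ⊔ lsuc ℓ′)
  Subset k ℓ′ = Vecℝ k → Set ℓ′

  -- z ∈ Z(H_x)  iff  H(x,z) = 0 ;  z ∈ Z(H^y)  iff  H(z,y) = 0
  Z-sub : ∀ {k} → Poly2 k → Vecℝ k → Vecℝ k → Set ℓ
  Z-sub H x z = evalH H x z ≈ 0#

  Z-sup : ∀ {k} → Poly2 k → Vecℝ k → Vecℝ k → Set ℓ
  Z-sup H y z = evalH H z y ≈ 0#

  -- Restricted Zariski closure: z lies in every Z(H_x) containing X and in
  -- every Z(H^y) containing X (empty intersection = ℝ^k automatically).
  closureH : ∀ {k ℓ′} → Poly2 k → Subset k ℓ′ → Subset k (c ⊔ ℓ ⊔ ℓ′)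
  closureH H X z =
    (∀ x → (∀ w → X w → Z-sub H x w) → Z-sub H x z) ×
    (∀ y → (∀ w → X w → Z-sup H y w) → Z-sup H y z)

module Submission where

open import Defs
open import Level using (Level)
open import Data.Nat using (ℕ)
open import Data.Product using (∃; proj₁; proj₂)

module _ {c ℓ ℓ′ : Level} (R : RealField c ℓ) {k : ℕ} (H : Poly2 R k)
         (X : Subset R k ℓ′) where
  open RealField R using (_≈_; 0#)

  -- If H vanishes on X × X, each H_w with w ∈ X vanishes on X, so the closure
  -- of X lies in every such Z(H_w).
  closureH⊆Z-sub : (∀ x y → X x → X y → evalH R H x y ≈ 0#) →
                   ∀ w y → X w → closureH R H X y → Z-sub R H w y
  closureH⊆Z-sub hX w y Xw cy = proj₁ cy w (λ v Xv → hX w v Xw Xv)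

lemma3p1 : ∀ {c ℓ ℓ′ : Level} (R : RealField c ℓ) (k : ℕ) (H : Poly2 R k)
    (X : Subset R k ℓ′) →
    (∃ λ x → X x) →
    (∀ x y → X x → X y → RealField._≈_ R (evalH R H x y) (RealField.0# R)) →
    ∀ x y → closureH R H X x → closureH R H X y →
    RealField._≈_ R (evalH R H x y) (RealField.0# R)
lemma3p1 R k H X _ hX x y cx cy =
  proj₂ cx y (λ w Xw → closureH⊆Z-sub R H X hX w y Xw cy)
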